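{- Let $n$ be a multiple of $k$. For $G=\mathrm{Comet}(n,k)$ and $\tilde G=\mathrm{Comet}(2n,2k)$, with stationary distributions $\pi_G$ and $\pi_{\tilde G}$ of the lazy random walk, it holds that $\|\pi_G-\pi_{\tilde G}\|_{TV}=O\left(\left(\frac kn\right)^{k-1}\right)$.
   Context: $\mathrm{Comet}(n,k)$ (for $k\mid n$) is the directed graph with "centres" $v_1,\dots,v_k$ forming a directed cycle $(v_i,v_{i+1})$ for $1\le i<k$ and $(v_k,v_1)$; for each $\ell\in[k]$ a directed star with edges $(v_\ell,v_{\ell,j})$ for $j\in[n/k-1]$; and for every leaf $v_{\ell,j}$ an edge $(v_{\ell,j},v_1)$. Note $\mathrm{Comet}(2n,2k)$ has the same star sizes $n/k-1$, and its nodes $v_\ell,v_{\ell,j}$ with $\ell\le k$ are identified with those of $\mathrm{Comet}(n,k)$; $\pi_G$ is extended by $0$ on the remaining nodes. The lazy random walk on a directed graph stays put with probability $1/2$ and otherwise moves to a uniformly random out-neighbour. $\|\mu-\nu\|_{TV}=\frac12\sum_x|\mu(x)-\nu(x)|$. -}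

module Defs where

open import Data.Bool using (Bool; true; false; if_then_else_; _∧_; _∨_)
open import Data.Nat as ℕ using (ℕ; zero; suc; _≡ᵇ_)
open import Data.Fin as Fin using (Fin; zero; suc; toℕ; splitAt)
open import Data.Product using (_×_; _,_)
open import Data.Sum using (inj₁; inj₂)
open import Data.Integer using (+_)
open import Relation.Binary.PropositionalEquality using (_≡_)
open import Data.Rational using (ℚ; 0ℚ; 1ℚ; ½; _+_; _-_; _*_; _/_; ∣_∣; _≤_)

sumFin : (n : ℕ) → (Fin n → ℚ) → ℚ
sumFin zero    f = 0ℚ
sumFin (suc n) f = f zero + sumFin n (λ i → f (suc i))

countFin : (n : ℕ) → (Fin n → Bool) → ℕ
countFin zero    f = 0
countFin (suc n) f = (if f zero then 1 else 0) ℕ.+ countFin n (λ i → f (suc i))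

sumNatFin : (n : ℕ) → (Fin n → ℕ) → ℕ
sumNatFin zero    f = 0
sumNatFin (suc n) f = f zero ℕ.+ sumNatFin n (λ i → f (suc i))

_^_ : ℚ → ℕ → ℚ
p ^ zero  = 1ℚ
p ^ suc e = p * (p ^ e)

-- 1/d for d ≥ 1 (and 0 for d = 0; never used, every node has out-degree ≥ 1).
recip : ℕ → ℚ
recip zero    = 0ℚ
recip (suc d) = + 1 / suc d

-- Nodes of Comet(k·m, k): the pair (l , zero) is the centre v_{l+1},
-- the pair (l , suc j) is the leaf v_{l+1, j+1}  (j+1 ∈ [m-1]).
Node : ℕ → ℕ → Set
Node k m = Fin k × Fin m

sumNode : (k m : ℕ) → (Node k m → ℚ) → ℚ
sumNode k m f = sumFin k (λ l → sumFin m (λ j → f (l , j)))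

countNode : (k m : ℕ) → (Node k m → Bool) → ℕ
countNode k m f = sumNatFin k (λ l → countFin m (λ j → f (l , j)))

eqNode : {k m : ℕ} → Node k m → Node k m → Bool
eqNode (l , j) (l' , j') = (toℕ l ≡ᵇ toℕ l') ∧ (toℕ j ≡ᵇ toℕ j')

cycleEdge : {k : ℕ} → Fin k → Fin k → Bool
cycleEdge {k} l l' =
  (suc (toℕ l) ≡ᵇ toℕ l') ∨ ((suc (toℕ l) ≡ᵇ k) ∧ (toℕ l' ≡ᵇ 0))

adj : {k m : ℕ} → Node k m → Node k m → Bool
adj (l , zero)  (l' , zero)  = cycleEdge l l'
adj (l , zero)  (l' , suc _) = toℕ l ≡ᵇ toℕ l'
adj (l , suc _) (l' , zero)  = toℕ l' ≡ᵇ 0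
adj (l , suc _) (l' , suc _) = false

outdeg : (k m : ℕ) → Node k m → ℕ
outdeg k m x = countNode k m (adj x)

lazyP : (k m : ℕ) → Node k m → Node k m → ℚ
lazyP k m x y =
  (if eqNode x y then ½ else 0ℚ) + (if adj x y then ½ * recip (outdeg k m x) else 0ℚ)

record IsStationary (k m : ℕ) (π : Node k m → ℚ) : Set where
  field
    nonneg     : ∀ x → 0ℚ ≤ π x
    total      : sumNode k m π ≡ 1ℚ
    stationary : ∀ y → sumNode k m (λ x → π x * lazyP k m x y) ≡ π y

extend : (k m : ℕ) → (Node k m → ℚ) → Node (2 ℕ.* k) m → ℚ
extend k m π (l , j) with splitAt k l
... | inj₁ l' = π (l' , j)
... | inj₂ _  = 0ℚ

tv : (k m : ℕ) → (Node k m → ℚ) → (Node k m → ℚ) → ℚ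
tv k m μ ν = ½ * sumNode k m (λ x → ∣ μ x - ν x ∣)

module Submission where

-- Every node of Comet(n,k) other than v₁ has a single in-neighbour, and it is a centre, of out-degree
-- m = n/k.  Stationarity at such a node y reads π y = π y / 2 + π(parent) / (2m), i.e. π y = π(parent) / m,
-- so π(v_{l+1}) = π(v₁) m^(-l) and π(v_{l+1,j}) = π(v₁) m^(-l-1), on Comet(n,k) and Comet(2n,2k) alike.
-- The two stationary distributions are thus proportional on the nodes they share, which makes their
-- total variation distance exactly the mass π̃ puts on the new centres v_{k+1}, …, v_{2k} and their
-- stars.  That mass is m^(-k) times the mass on the old nodes, hence at most m^(-k) ≤ (k/n)^(k-1).

module CometStationary where

  open import Defs
  open import Data.Bool using (Bool; true; false; if_then_else_; _∧_; _∨_)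
  open import Data.Bool.Properties using (∨-identityʳ; ∧-zeroʳ; T-≡)
  open import Data.Nat as ℕ using (ℕ; zero; suc; _≡ᵇ_; _%_; s≤s; z≤n)
  import Data.Nat.Properties as ℕₚ
  open import Data.Nat.DivMod using (m%n<n; m<n⇒m%n≡m; n%n≡0)
  open import Data.Fin using (Fin; zero; suc; toℕ; fromℕ<; _↑ˡ_; _↑ʳ_)
  import Data.Fin.Properties as Finₚ
  open import Data.Product using (_,_; proj₁; proj₂)
  open import Data.Sum using (_⊎_; inj₁; inj₂; [_,_]′; map₁)
  open import Data.Empty using (⊥-elim)
  open import Function using (_∘_; id; Equivalence; mk⇔)
  open import Relation.Nullary using (yes; no)
  open import Relation.Nullary.Decidable using (dec-true; dec-false; does-⇔)
  open import Relation.Binary.PropositionalEquality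
  open import Data.Rational using (ℚ; 0ℚ; 1ℚ; ½; _+_; _-_; -_; _*_; _/_; ∣_∣; _≤_; nonNegative)
  open import Data.Rational.Properties
  open import Data.Rational.Unnormalised as ℚᵘ using (mkℚᵘ)
  import Data.Rational.Unnormalised.Properties as ℚᵘₚ
  import Data.Integer as ℤ
  open import Algebra.Bundles using (CommutativeMonoid)
  open import Algebra.Properties.CommutativeSemigroup using (interchange)
  open import Data.Rational.Solver using (module +-*-Solver)
  open +-*-Solver

  sumFin-cong : ∀ n {f g : Fin n → ℚ} → (∀ i → f i ≡ g i) → sumFin n f ≡ sumFin n g
  sumFin-cong zero    f≗g = refl
  sumFin-cong (suc n) f≗g = cong₂ _+_ (f≗g zero) (sumFin-cong n (f≗g ∘ suc))

  sumFin-vanishing : ∀ n {f : Fin n → ℚ} → (∀ i → f i ≡ 0ℚ) → sumFin n f ≡ 0ℚ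
  sumFin-vanishing zero    f≗0 = refl
  sumFin-vanishing (suc n) f≗0 =
    trans (cong₂ _+_ (f≗0 zero) (sumFin-vanishing n (f≗0 ∘ suc))) (+-identityʳ 0ℚ)

  sumFin-+ : ∀ n (f g : Fin n → ℚ) → sumFin n (λ i → f i + g i) ≡ sumFin n f + sumFin n g
  sumFin-+ zero    f g = sym (+-identityʳ 0ℚ)
  sumFin-+ (suc n) f g = trans (cong (f zero + g zero +_) (sumFin-+ n (f ∘ suc) (g ∘ suc)))
    (interchange (CommutativeMonoid.commutativeSemigroup +-0-commutativeMonoid) (f zero) (g zero) _ _)

  sumFin-*ˡ : ∀ n c (f : Fin n → ℚ) → sumFin n (λ i → c * f i) ≡ c * sumFin n f
  sumFin-*ˡ zero    c f = sym (*-zeroʳ c)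
  sumFin-*ˡ (suc n) c f = trans (cong (c * f zero +_) (sumFin-*ˡ n c (f ∘ suc)))
    (sym (*-distribˡ-+ c (f zero) (sumFin n (f ∘ suc))))

  sumFin-single : ∀ n (f : Fin n → ℚ) i → (∀ j → j ≡ i ⊎ f j ≡ 0ℚ) → sumFin n f ≡ f i
  sumFin-single (suc n) f zero    only =
    trans (cong (f zero +_) (sumFin-vanishing n (λ j → [ (λ ()) , id ]′ (only (suc j)))))
          (+-identityʳ (f zero))
  sumFin-single (suc n) f (suc i) only =
    trans (cong₂ _+_ ([ (λ ()) , id ]′ (only zero))
                     (sumFin-single n (f ∘ suc) i (λ j → map₁ Finₚ.suc-injective (only (suc j)))))
          (+-identityˡ (f (suc i)))

  sumFin-++ : ∀ n₁ n₂ (f : Fin (n₁ ℕ.+ n₂) → ℚ) →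
    sumFin (n₁ ℕ.+ n₂) f ≡ sumFin n₁ (λ i → f (i ↑ˡ n₂)) + sumFin n₂ (λ i → f (n₁ ↑ʳ i))
  sumFin-++ zero     n₂ f = sym (+-identityˡ _)
  sumFin-++ (suc n₁) n₂ f = trans (cong (f zero +_) (sumFin-++ n₁ n₂ (f ∘ suc)))
    (sym (+-assoc (f zero) _ _))

  sumFin-nonNeg : ∀ n (f : Fin n → ℚ) → (∀ i → 0ℚ ≤ f i) → 0ℚ ≤ sumFin n f
  sumFin-nonNeg zero    f 0≤f = ≤-refl
  sumFin-nonNeg (suc n) f 0≤f =
    subst (_≤ sumFin (suc n) f) (+-identityʳ 0ℚ)
          (+-mono-≤ (0≤f zero) (sumFin-nonNeg n (f ∘ suc) (0≤f ∘ suc)))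

  sumNode-cong : ∀ K M {f g : Node K M → ℚ} → (∀ x → f x ≡ g x) → sumNode K M f ≡ sumNode K M g
  sumNode-cong K M f≗g = sumFin-cong K (λ l → sumFin-cong M (λ j → f≗g (l , j)))

  sumNode-+ : ∀ K M (f g : Node K M → ℚ) → sumNode K M (λ x → f x + g x) ≡ sumNode K M f + sumNode K M g
  sumNode-+ K M f g = trans (sumFin-cong K (λ l → sumFin-+ M _ _)) (sumFin-+ K _ _)

  sumNode-*ˡ : ∀ K M c (f : Node K M → ℚ) → sumNode K M (λ x → c * f x) ≡ c * sumNode K M f
  sumNode-*ˡ K M c f = trans (sumFin-cong K (λ l → sumFin-*ˡ M c _)) (sumFin-*ˡ K c _)

  sumNode-nonNeg : ∀ K M (f : Node K M → ℚ) → (∀ x → 0ℚ ≤ f x) → 0ℚ ≤ sumNode K M f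
  sumNode-nonNeg K M f 0≤f = sumFin-nonNeg K _ (λ l → sumFin-nonNeg M _ (λ j → 0≤f (l , j)))

  sumNode-single : ∀ K M (f : Node K M → ℚ) p → (∀ x → x ≡ p ⊎ f x ≡ 0ℚ) → sumNode K M f ≡ f p
  sumNode-single K M f (l , j) only =
    trans (sumFin-single K _ l onlyRow) (sumFin-single M _ j (λ j′ → map₁ (cong proj₂) (only (l , j′))))
    where
    onlyRow : ∀ l′ → l′ ≡ l ⊎ sumFin M (λ j′ → f (l′ , j′)) ≡ 0ℚ
    onlyRow l′ with l′ Finₚ.≟ l
    ... | yes l′≡l = inj₁ l′≡l
    ... | no  l′≢l =
      inj₂ (sumFin-vanishing M (λ j′ → [ ⊥-elim ∘ l′≢l ∘ cong proj₁ , id ]′ (only (l′ , j′))))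

  sumNode-++ : ∀ K₁ K₂ M (f : Node (K₁ ℕ.+ K₂) M → ℚ) →
    sumNode (K₁ ℕ.+ K₂) M f ≡
    sumNode K₁ M (λ (l , j) → f (l ↑ˡ K₂ , j)) + sumNode K₂ M (λ (l , j) → f (K₁ ↑ʳ l , j))
  sumNode-++ K₁ K₂ M f = sumFin-++ K₁ K₂ (λ l → sumFin M (λ j → f (l , j)))

  *-if-supported : ∀ {A : Set} (f : A → ℚ) (b : A → Bool) (c : A → ℚ) p →
    (∀ x → b x ≡ true → x ≡ p) → ∀ x → x ≡ p ⊎ f x * (if b x then c x else 0ℚ) ≡ 0ℚ
  *-if-supported f b c p only x with b x in bx
  ... | true  = inj₁ (only x bx)
  ... | false = inj₂ (*-zeroʳ (f x))

  sumNatFin-cong : ∀ n {f g : Fin n → ℕ} → (∀ i → f i ≡ g i) → sumNatFin n f ≡ sumNatFin n g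
  sumNatFin-cong zero    f≗g = refl
  sumNatFin-cong (suc n) f≗g = cong₂ ℕ._+_ (f≗g zero) (sumNatFin-cong n (f≗g ∘ suc))

  sumNatFin-zero : ∀ n → sumNatFin n (λ _ → 0) ≡ 0
  sumNatFin-zero zero    = refl
  sumNatFin-zero (suc n) = sumNatFin-zero n

  sumNatFin-+ : ∀ n (f g : Fin n → ℕ) →
    sumNatFin n (λ i → f i ℕ.+ g i) ≡ sumNatFin n f ℕ.+ sumNatFin n g
  sumNatFin-+ zero    f g = refl
  sumNatFin-+ (suc n) f g = trans (cong (f zero ℕ.+ g zero ℕ.+_) (sumNatFin-+ n (f ∘ suc) (g ∘ suc)))
    (interchange ℕₚ.+-commutativeSemigroup (f zero) (g zero) _ _)

  sumNatFin-indicator : ∀ n c v → c ℕ.< n → sumNatFin n (λ j → if c ≡ᵇ toℕ j then v else 0) ≡ v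
  sumNatFin-indicator (suc n) zero    v _         = trans (cong (v ℕ.+_) (sumNatFin-zero n)) (ℕₚ.+-identityʳ v)
  sumNatFin-indicator (suc n) (suc c) v (s≤s c<n) = sumNatFin-indicator n c v c<n

  countFin-const : ∀ n b → countFin n (λ _ → b) ≡ (if b then n else 0)
  countFin-const zero    true  = refl
  countFin-const zero    false = refl
  countFin-const (suc n) true  = cong suc (countFin-const n true)
  countFin-const (suc n) false = countFin-const n false

  ½-fixpoint : ∀ a b → a ≡ a * ½ + b * ½ → a ≡ b
  ½-fixpoint a b a≡ = sym (begin
    b                       ≡⟨ solve 2 (λ a b → b := (a :* con ½ :+ b :* con ½) :* con 2ℚ :- a) refl a b ⟩
    (a * ½ + b * ½) * 2ℚ - a ≡⟨ cong (λ c → c * 2ℚ - a) (sym a≡) ⟩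
    a * 2ℚ - a              ≡⟨ solve 1 (λ a → a :* con 2ℚ :- a := a) refl a ⟩
    a                       ∎)
    where
    open ≡-Reasoning
    2ℚ : ℚ
    2ℚ = 1ℚ + 1ℚ

  *-^-suc : ∀ a r s → a * r ^ s * r ≡ a * r ^ suc s
  *-^-suc a r s = trans (*-assoc a (r ^ s) r) (cong (a *_) (*-comm (r ^ s) r))

  ^-+ : ∀ r s t → r ^ (s ℕ.+ t) ≡ r ^ s * r ^ t
  ^-+ r zero    t = sym (*-identityˡ (r ^ t))
  ^-+ r (suc s) t = trans (cong (r *_) (^-+ r s t)) (sym (*-assoc r (r ^ s) (r ^ t)))

  ^-nonNeg : ∀ {r} → 0ℚ ≤ r → ∀ t → 0ℚ ≤ r ^ t
  ^-nonNeg 0≤r zero    = nonNegative⁻¹ 1ℚ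
  ^-nonNeg {r} 0≤r (suc t) =
    nonNegative⁻¹ _ {{nonNeg*nonNeg⇒nonNeg r {{nonNegative 0≤r}} (r ^ t) {{nonNegative (^-nonNeg 0≤r t)}}}}

  ^-suc≤ : ∀ {r} → 0ℚ ≤ r → r ≤ 1ℚ → ∀ t → r ^ suc t ≤ r ^ t
  ^-suc≤ {r} 0≤r r≤1 t =
    ≤-trans (*-monoʳ-≤-nonNeg (r ^ t) {{nonNegative (^-nonNeg 0≤r t)}} r≤1)
            (≤-reflexive (*-identityˡ (r ^ t)))

  recip-nonNeg : ∀ m → 0ℚ ≤ recip (suc m)
  recip-nonNeg m = nonNegative⁻¹ (recip (suc m)) {{normalize-nonNeg 1 (suc m)}}

  recip≤1 : ∀ m → recip (suc m) ≤ 1ℚ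
  recip≤1 m = toℚᵘ-cancel-≤
    (ℚᵘₚ.≤-respˡ-≃ (ℚᵘₚ.≃-sym (toℚᵘ-fromℚᵘ (mkℚᵘ (ℤ.+ 1) m))) (ℚᵘ.*≤* (ℤ.+≤+ (s≤s z≤n))))

  -- mkℚᵘ takes the denominator minus one, and suc m * suc k unfolds to suc (k + m * suc k).
  +k/[m*k]≡recip-m : ∀ k m → ℤ.+ suc k / (suc m ℕ.* suc k) ≡ recip (suc m)
  +k/[m*k]≡recip-m k m = fromℚᵘ-cong {mkℚᵘ (ℤ.+ suc k) (k ℕ.+ m ℕ.* suc k)} {mkℚᵘ (ℤ.+ 1) m}
    (ℚᵘ.*≡* (cong ℤ.+_ (trans (ℕₚ.*-comm (suc k) (suc m)) (sym (ℕₚ.*-identityˡ _)))))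

  ∣*-*∣ : ∀ a b q → 0ℚ ≤ q → ∣ a * q - b * q ∣ ≡ ∣ a - b ∣ * q
  ∣*-*∣ a b q 0≤q = begin
    ∣ a * q - b * q ∣   ≡⟨ cong ∣_∣ (solve 3 (λ a b q → a :* q :- b :* q := (a :- b) :* q) refl a b q) ⟩
    ∣ (a - b) * q ∣     ≡⟨ ∣p*q∣≡∣p∣*∣q∣ (a - b) q ⟩
    ∣ a - b ∣ * ∣ q ∣   ≡⟨ cong (∣ a - b ∣ *_) (0≤p⇒∣p∣≡p 0≤q) ⟩
    ∣ a - b ∣ * q       ∎
    where open ≡-Reasoning

  sumNode-∣*-*∣ : ∀ K M (ρ : Node K M → ℚ) → (∀ x → 0ℚ ≤ ρ x) → ∀ a b →
    sumNode K M (λ x → ∣ a * ρ x - b * ρ x ∣) ≡ ∣ a * sumNode K M ρ - b * sumNode K M ρ ∣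
  sumNode-∣*-*∣ K M ρ 0≤ρ a b = begin
    sumNode K M (λ x → ∣ a * ρ x - b * ρ x ∣) ≡⟨ sumNode-cong K M (λ x → ∣*-*∣ a b (ρ x) (0≤ρ x)) ⟩
    sumNode K M (λ x → ∣ a - b ∣ * ρ x)       ≡⟨ sumNode-*ˡ K M ∣ a - b ∣ ρ ⟩
    ∣ a - b ∣ * sumNode K M ρ                 ≡⟨ sym (∣*-*∣ a b _ (sumNode-nonNeg K M ρ 0≤ρ)) ⟩
    ∣ a * sumNode K M ρ - b * sumNode K M ρ ∣ ∎
    where open ≡-Reasoning

  ≡ᵇ-sym : ∀ a b → (a ≡ᵇ b) ≡ (b ≡ᵇ a)
  ≡ᵇ-sym a b = does-⇔ (mk⇔ sym sym) (a ℕₚ.≟ b) (b ℕₚ.≟ a)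

  ≡ᵇ-true⇒≡ : ∀ {a b} → (a ≡ᵇ b) ≡ true → a ≡ b
  ≡ᵇ-true⇒≡ {a} {b} e = ℕₚ.≡ᵇ⇒≡ a b (Equivalence.from T-≡ e)

  cycleEdge≡succ% : ∀ {K} (l l′ : Fin (suc K)) → cycleEdge l l′ ≡ (suc (toℕ l) % suc K ≡ᵇ toℕ l′)
  cycleEdge≡succ% {K} l l′ with ℕₚ.m≤n⇒m<n∨m≡n (Finₚ.toℕ<n l)
  ... | inj₁ 1+l<K = begin
    (suc (toℕ l) ≡ᵇ toℕ l′) ∨ ((suc (toℕ l) ≡ᵇ suc K) ∧ (toℕ l′ ≡ᵇ 0))
      ≡⟨ cong (λ b → (suc (toℕ l) ≡ᵇ toℕ l′) ∨ (b ∧ (toℕ l′ ≡ᵇ 0)))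
              (dec-false (_ ℕₚ.≟ _) (ℕₚ.<⇒≢ 1+l<K)) ⟩
    (suc (toℕ l) ≡ᵇ toℕ l′) ∨ false
      ≡⟨ ∨-identityʳ _ ⟩
    suc (toℕ l) ≡ᵇ toℕ l′
      ≡⟨ cong (_≡ᵇ toℕ l′) (sym (m<n⇒m%n≡m 1+l<K)) ⟩
    suc (toℕ l) % suc K ≡ᵇ toℕ l′ ∎
    where open ≡-Reasoning
  ... | inj₂ 1+l≡K = begin
    (suc (toℕ l) ≡ᵇ toℕ l′) ∨ ((suc (toℕ l) ≡ᵇ suc K) ∧ (toℕ l′ ≡ᵇ 0))
      ≡⟨ cong₂ (λ b c → b ∨ (c ∧ (toℕ l′ ≡ᵇ 0)))
               (dec-false (_ ℕₚ.≟ _) (λ e → ℕₚ.<⇒≢ (Finₚ.toℕ<n l′) (trans (sym e) 1+l≡K)))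
               (dec-true (_ ℕₚ.≟ _) 1+l≡K) ⟩
    toℕ l′ ≡ᵇ 0
      ≡⟨ ≡ᵇ-sym (toℕ l′) 0 ⟩
    0 ≡ᵇ toℕ l′
      ≡⟨ cong (_≡ᵇ toℕ l′) (sym (trans (cong (_% suc K) 1+l≡K) (n%n≡0 (suc K)))) ⟩
    suc (toℕ l) % suc K ≡ᵇ toℕ l′ ∎
    where open ≡-Reasoning

  cycleEdge-into-suc : ∀ {K} (l t : Fin K) {s} → toℕ t ≡ suc s → cycleEdge l t ≡ (toℕ l ≡ᵇ s)
  cycleEdge-into-suc {K} l t t≡1+s rewrite t≡1+s =
    trans (cong ((toℕ l ≡ᵇ _) ∨_) (∧-zeroʳ (suc (toℕ l) ≡ᵇ K))) (∨-identityʳ _)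

  outdeg-centre : ∀ K m (l : Fin (suc K)) → outdeg (suc K) (suc m) (l , zero) ≡ suc m
  outdeg-centre K m l = begin
    sumNatFin (suc K) (λ l′ → indicator (cycleEdge l l′) 1 ℕ.+ countFin m (λ _ → toℕ l ≡ᵇ toℕ l′))
      ≡⟨ sumNatFin-+ (suc K) (λ l′ → indicator (cycleEdge l l′) 1)
                              (λ l′ → countFin m (λ _ → toℕ l ≡ᵇ toℕ l′)) ⟩
    sumNatFin (suc K) (λ l′ → indicator (cycleEdge l l′) 1)
      ℕ.+ sumNatFin (suc K) (λ l′ → countFin m (λ _ → toℕ l ≡ᵇ toℕ l′))
      ≡⟨ cong₂ ℕ._+_ cycleEdges leafEdges ⟩
    1 ℕ.+ m ∎
    where
    open ≡-Reasoning
    indicator : Bool → ℕ → ℕ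
    indicator b v = if b then v else 0
    cycleEdges : sumNatFin (suc K) (λ l′ → indicator (cycleEdge l l′) 1) ≡ 1
    cycleEdges = trans (sumNatFin-cong (suc K) (λ l′ → cong (λ b → indicator b 1) (cycleEdge≡succ% l l′)))
                       (sumNatFin-indicator (suc K) _ 1 (m%n<n (suc (toℕ l)) (suc K)))
    leafEdges : sumNatFin (suc K) (λ l′ → countFin m (λ _ → toℕ l ≡ᵇ toℕ l′)) ≡ m
    leafEdges = trans (sumNatFin-cong (suc K) (λ l′ → countFin-const m (toℕ l ≡ᵇ toℕ l′)))
                      (sumNatFin-indicator (suc K) (toℕ l) m (Finₚ.toℕ<n l))

  eqNode-true⇒≡ : ∀ {K M} (x y : Node K M) → eqNode x y ≡ true → x ≡ y
  eqNode-true⇒≡ (l , j) (l′ , j′) e with toℕ l ≡ᵇ toℕ l′ in el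
  ... | true = cong₂ _,_ (Finₚ.toℕ-injective (≡ᵇ-true⇒≡ el))
                         (Finₚ.toℕ-injective (≡ᵇ-true⇒≡ e))

  eqNode-refl : ∀ {K M} (x : Node K M) → eqNode x x ≡ true
  eqNode-refl (l , j)
    rewrite dec-true (toℕ l ℕₚ.≟ toℕ l) refl | dec-true (toℕ j ℕₚ.≟ toℕ j) refl = refl

  depth : ∀ {M} → ℕ → Fin M → ℕ
  depth t zero    = t
  depth t (suc _) = suc t

  depth-+ : ∀ {M} s t (j : Fin M) → depth (s ℕ.+ t) j ≡ s ℕ.+ depth t j
  depth-+ s t zero    = refl
  depth-+ s t (suc j) = sym (ℕₚ.+-suc s t)

  profile : ∀ {K M} → ℚ → Node K M → ℚ
  profile r (l , j) = r ^ depth (toℕ l) j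

  profile-nonNeg : ∀ {K M r} → 0ℚ ≤ r → ∀ (x : Node K M) → 0ℚ ≤ profile r x
  profile-nonNeg 0≤r (l , j) = ^-nonNeg 0≤r (depth (toℕ l) j)

  module Stationary {K m : ℕ} {π : Node (suc K) (suc m) → ℚ} (st : IsStationary (suc K) (suc m) π) where

    open IsStationary st

    r : ℚ
    r = recip (suc m)

    π-from-parent : ∀ y p → (∀ x → adj x y ≡ true → x ≡ (p , zero)) → adj (p , zero) y ≡ true →
      π y ≡ π (p , zero) * r
    π-from-parent y p parent p→y = ½-fixpoint (π y) (π (p , zero) * r) (begin
      π y
        ≡⟨ sym (stationary y) ⟩
      sumNode (suc K) (suc m) (λ x → π x * lazyP (suc K) (suc m) x y)
        ≡⟨ sumNode-cong (suc K) (suc m) (λ x → *-distribˡ-+ (π x) (stay x) (move x)) ⟩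
      sumNode (suc K) (suc m) (λ x → π x * stay x + π x * move x)
        ≡⟨ sumNode-+ (suc K) (suc m) (λ x → π x * stay x) (λ x → π x * move x) ⟩
      sumNode (suc K) (suc m) (λ x → π x * stay x) + sumNode (suc K) (suc m) (λ x → π x * move x)
        ≡⟨ cong₂ _+_ (sumNode-single _ _ _ y onlyAt-y) (sumNode-single _ _ _ (p , zero) onlyAt-p) ⟩
      π y * stay y + π (p , zero) * move (p , zero)
        ≡⟨ cong₂ (λ s t → π y * s + π (p , zero) * t)
             (cong (λ b → if b then ½ else 0ℚ) (eqNode-refl y))
             (cong₂ (λ b d → if b then ½ * recip d else 0ℚ) p→y (outdeg-centre K m p)) ⟩
      π y * ½ + π (p , zero) * (½ * r)
        ≡⟨ cong (π y * ½ +_) (solve 3 (λ a h r → a :* (h :* r) := a :* r :* h) refl (π (p , zero)) ½ r) ⟩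
      π y * ½ + π (p , zero) * r * ½ ∎)
      where
      open ≡-Reasoning
      stay move : Node (suc K) (suc m) → ℚ
      stay x = if eqNode x y then ½ else 0ℚ
      move x = if adj x y then ½ * recip (outdeg (suc K) (suc m) x) else 0ℚ
      onlyAt-y : ∀ x → x ≡ y ⊎ π x * stay x ≡ 0ℚ
      onlyAt-y = *-if-supported π (λ x → eqNode x y) _ y (λ x → eqNode-true⇒≡ x y)
      onlyAt-p : ∀ x → x ≡ (p , zero) ⊎ π x * move x ≡ 0ℚ
      onlyAt-p = *-if-supported π (λ x → adj x y) _ (p , zero) parent

    π-leaf : ∀ l j → π (l , suc j) ≡ π (l , zero) * r
    π-leaf l j = π-from-parent (l , suc j) l parent (dec-true (toℕ l ℕₚ.≟ toℕ l) refl)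
      where
      parent : ∀ x → adj x (l , suc j) ≡ true → x ≡ (l , zero)
      parent (l′ , zero)  e = cong (_, zero) (Finₚ.toℕ-injective (≡ᵇ-true⇒≡ e))
      parent (l′ , suc _) ()

    π-centre-suc : ∀ l p → toℕ l ≡ suc (toℕ p) → π (l , zero) ≡ π (p , zero) * r
    π-centre-suc l p l≡1+p = π-from-parent (l , zero) p parent p→l
      where
      parent : ∀ x → adj x (l , zero) ≡ true → x ≡ (p , zero)
      parent (l′ , zero)  e =
        cong (_, zero) (Finₚ.toℕ-injective (≡ᵇ-true⇒≡ (trans (sym (cycleEdge-into-suc l′ l l≡1+p)) e)))
      parent (l′ , suc _) e with () ← trans (sym (cong (_≡ᵇ 0) l≡1+p)) e
      p→l : cycleEdge p l ≡ true
      p→l = trans (cycleEdge-into-suc p l l≡1+p) (dec-true (toℕ p ℕₚ.≟ toℕ p) refl)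

    π₀ : ℚ
    π₀ = π (zero , zero)

    π-centre : ∀ s l → toℕ l ≡ s → π (l , zero) ≡ π₀ * r ^ s
    π-centre zero    l l≡0   =
      trans (cong (λ l → π (l , zero)) (Finₚ.toℕ-injective l≡0)) (sym (*-identityʳ π₀))
    π-centre (suc s) l l≡1+s = begin
      π (l , zero)     ≡⟨ π-centre-suc l p (trans l≡1+s (cong suc (sym p≡s))) ⟩
      π (p , zero) * r ≡⟨ cong (_* r) (π-centre s p p≡s) ⟩
      π₀ * r ^ s * r   ≡⟨ *-^-suc π₀ r s ⟩
      π₀ * r ^ suc s   ∎
      where
      open ≡-Reasoning
      s<K : s ℕ.< suc K
      s<K = ℕₚ.<⇒≤ (subst (ℕ._< suc K) l≡1+s (Finₚ.toℕ<n l))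
      p : Fin (suc K)
      p = fromℕ< s<K
      p≡s : toℕ p ≡ s
      p≡s = Finₚ.toℕ-fromℕ< s<K

    π≡π₀*profile : ∀ x → π x ≡ π₀ * profile r x
    π≡π₀*profile (l , zero)  = π-centre (toℕ l) l refl
    π≡π₀*profile (l , suc j) =
      trans (π-leaf l j) (trans (cong (_* r) (π-centre (toℕ l) l refl)) (*-^-suc π₀ r (toℕ l)))

  module Doubling {k m : ℕ} {π : Node (suc k) (suc m) → ℚ} {π̃ : Node (2 ℕ.* suc k) (suc m) → ℚ}
                  (st : IsStationary (suc k) (suc m) π) (st̃ : IsStationary (2 ℕ.* suc k) (suc m) π̃) where

    K M : ℕ
    K = suc k
    M = suc m

    r : ℚ
    r = recip M

    -- 2 * K unfolds to K + (K + 0): the centres of Comet(n,k) come first, the K new ones after them.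
    old : Node K M → Node (2 ℕ.* K) M
    old (l , j) = (l ↑ˡ (K ℕ.+ 0) , j)

    new : Node (K ℕ.+ 0) M → Node (2 ℕ.* K) M
    new (l , j) = (K ↑ʳ l , j)

    oldMass newMass : ℚ
    oldMass = sumNode K M (π̃ ∘ old)
    newMass = sumNode (K ℕ.+ 0) M (π̃ ∘ new)

    R : ℕ → ℚ
    R K′ = sumNode K′ M (profile r)

    open Stationary st  using () renaming (π₀ to a; π≡π₀*profile to π≡a*profile)
    open Stationary st̃ using () renaming (π₀ to b; π≡π₀*profile to π̃≡b*profile)

    a*R≡1 : a * R K ≡ 1ℚ
    a*R≡1 = begin
      a * R K                          ≡⟨ sym (sumNode-*ˡ K M a (profile r)) ⟩
      sumNode K M (λ x → a * profile r x) ≡⟨ sumNode-cong K M (sym ∘ π≡a*profile) ⟩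
      sumNode K M π                    ≡⟨ IsStationary.total st ⟩
      1ℚ                               ∎
      where open ≡-Reasoning

    oldMass+newMass≡1 : oldMass + newMass ≡ 1ℚ
    oldMass+newMass≡1 = trans (sym (sumNode-++ K (K ℕ.+ 0) M π̃)) (IsStationary.total st̃)

    π̃∘old≡b*profile : ∀ x → π̃ (old x) ≡ b * profile r x
    π̃∘old≡b*profile (l , j) =
      trans (π̃≡b*profile (old (l , j))) (cong (λ t → b * r ^ depth t j) (Finₚ.toℕ-↑ˡ l (K ℕ.+ 0)))

    oldMass≡b*R : oldMass ≡ b * R K
    oldMass≡b*R = trans (sumNode-cong K M π̃∘old≡b*profile) (sumNode-*ˡ K M b (profile r))

    newMass≡r^K*oldMass : newMass ≡ r ^ K * oldMass
    newMass≡r^K*oldMass = begin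
      newMass
        ≡⟨ sumNode-cong (K ℕ.+ 0) M π̃∘new≡b*r^K*profile ⟩
      sumNode (K ℕ.+ 0) M (λ x → b * (r ^ K * profile r x))
        ≡⟨ sumNode-*ˡ (K ℕ.+ 0) M b (λ x → r ^ K * profile r x) ⟩
      b * sumNode (K ℕ.+ 0) M (λ x → r ^ K * profile r x)
        ≡⟨ cong (b *_) (sumNode-*ˡ (K ℕ.+ 0) M (r ^ K) (profile r)) ⟩
      b * (r ^ K * R (K ℕ.+ 0))
        ≡⟨ cong (λ K′ → b * (r ^ K * R K′)) (ℕₚ.+-identityʳ K) ⟩
      b * (r ^ K * R K)
        ≡⟨ solve 3 (λ b x R → b :* (x :* R) := x :* (b :* R)) refl b (r ^ K) (R K) ⟩
      r ^ K * (b * R K)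
        ≡⟨ cong (r ^ K *_) (sym oldMass≡b*R) ⟩
      r ^ K * oldMass ∎
      where
      open ≡-Reasoning
      π̃∘new≡b*r^K*profile : ∀ x → π̃ (new x) ≡ b * (r ^ K * profile r x)
      π̃∘new≡b*r^K*profile (l , j) = begin
        π̃ (new (l , j))                  ≡⟨ π̃≡b*profile (new (l , j)) ⟩
        b * r ^ depth (toℕ (K ↑ʳ l)) j    ≡⟨ cong (λ t → b * r ^ depth t j) (Finₚ.toℕ-↑ʳ K l) ⟩
        b * r ^ depth (K ℕ.+ toℕ l) j     ≡⟨ cong (λ t → b * r ^ t) (depth-+ K (toℕ l) j) ⟩
        b * r ^ (K ℕ.+ depth (toℕ l) j)   ≡⟨ cong (b *_) (^-+ r K (depth (toℕ l) j)) ⟩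
        b * (r ^ K * profile r (l , j))   ∎

    newMass-nonNeg : 0ℚ ≤ newMass
    newMass-nonNeg = sumNode-nonNeg (K ℕ.+ 0) M (π̃ ∘ new) (IsStationary.nonneg st̃ ∘ new)

    oldMass≤1 : oldMass ≤ 1ℚ
    oldMass≤1 = subst₂ _≤_ (+-identityʳ oldMass) oldMass+newMass≡1 (+-monoʳ-≤ oldMass newMass-nonNeg)

    oldDistance≡newMass : sumNode K M (λ x → ∣ extend K M π (old x) - π̃ (old x) ∣) ≡ newMass
    oldDistance≡newMass = begin
      sumNode K M (λ x → ∣ extend K M π (old x) - π̃ (old x) ∣)
        ≡⟨ sumNode-cong K M (λ x → cong₂ (λ p q → ∣ p - q ∣) (extend-old x) (π̃∘old≡b*profile x)) ⟩
      sumNode K M (λ x → ∣ a * profile r x - b * profile r x ∣)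
        ≡⟨ sumNode-∣*-*∣ K M (profile r) (profile-nonNeg (recip-nonNeg m)) a b ⟩
      ∣ a * R K - b * R K ∣
        ≡⟨ cong₂ (λ p q → ∣ p - q ∣) a*R≡1 (sym oldMass≡b*R) ⟩
      ∣ 1ℚ - oldMass ∣
        ≡⟨ cong (λ p → ∣ p - oldMass ∣) (sym oldMass+newMass≡1) ⟩
      ∣ oldMass + newMass - oldMass ∣
        ≡⟨ cong ∣_∣ (solve 2 (λ p q → p :+ q :- p := q) refl oldMass newMass) ⟩
      ∣ newMass ∣
        ≡⟨ 0≤p⇒∣p∣≡p newMass-nonNeg ⟩
      newMass ∎
      where
      open ≡-Reasoning
      extend-old : ∀ x → extend K M π (old x) ≡ a * profile r x
      extend-old (l , j) rewrite Finₚ.splitAt-↑ˡ K l (K ℕ.+ 0) = π≡a*profile (l , j)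

    newDistance≡newMass : sumNode (K ℕ.+ 0) M (λ x → ∣ extend K M π (new x) - π̃ (new x) ∣) ≡ newMass
    newDistance≡newMass = sumNode-cong (K ℕ.+ 0) M distance
      where
      distance : ∀ x → ∣ extend K M π (new x) - π̃ (new x) ∣ ≡ π̃ (new x)
      distance (l , j) rewrite Finₚ.splitAt-↑ʳ K (K ℕ.+ 0) l =
        trans (cong ∣_∣ (+-identityˡ (- π̃ (new (l , j)))))
              (trans (∣-p∣≡∣p∣ (π̃ (new (l , j))))
                     (0≤p⇒∣p∣≡p (IsStationary.nonneg st̃ (new (l , j)))))

    tv≡newMass : tv (2 ℕ.* K) M (extend K M π) π̃ ≡ newMass
    tv≡newMass = begin
      tv (2 ℕ.* K) M (extend K M π) π̃
        ≡⟨ cong (½ *_) (sumNode-++ K (K ℕ.+ 0) M (λ x → ∣ extend K M π x - π̃ x ∣)) ⟩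
      ½ * (sumNode K M (λ x → ∣ extend K M π (old x) - π̃ (old x) ∣)
           + sumNode (K ℕ.+ 0) M (λ x → ∣ extend K M π (new x) - π̃ (new x) ∣))
        ≡⟨ cong (½ *_) (cong₂ _+_ oldDistance≡newMass newDistance≡newMass) ⟩
      ½ * (newMass + newMass)
        ≡⟨ solve 1 (λ p → con ½ :* (p :+ p) := p) refl newMass ⟩
      newMass ∎
      where open ≡-Reasoning

    tv≤r^k : tv (2 ℕ.* K) M (extend K M π) π̃ ≤ r ^ k
    tv≤r^k = begin
      tv (2 ℕ.* K) M (extend K M π) π̃ ≡⟨ trans tv≡newMass newMass≡r^K*oldMass ⟩
      r ^ K * oldMass                 ≤⟨ *-monoˡ-≤-nonNeg (r ^ K) {{nonNegative (^-nonNeg 0≤r K)}} oldMass≤1 ⟩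
      r ^ K * 1ℚ                      ≡⟨ *-identityʳ (r ^ K) ⟩
      r ^ K                           ≤⟨ ^-suc≤ 0≤r (recip≤1 m) k ⟩
      r ^ k                           ∎
      where
      open ≤-Reasoning
      0≤r : 0ℚ ≤ r
      0≤r = recip-nonNeg m

open import Defs
open import Data.Nat using (ℕ; NonZero; _/_; _∸_; _*_; zero; suc)
open import Data.Nat.Divisibility using (_∣_; divides)
open import Data.Nat.DivMod using (m*n/n≡m)
open import Data.Integer using (+_)
open import Data.Rational using (ℚ; _≤_; 1ℚ) renaming (_*_ to _*ℚ_; _/_ to _/ℚ_)
open import Data.Product using (∃-syntax; _,_)
open import Data.Rational.Properties using (*-identityˡ)
open import Relation.Binary.PropositionalEquality using (refl; sym; trans; cong; subst)
open CometStationary using (module Doubling; +k/[m*k]≡recip-m)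

lemma4 : ∃[ C ] ((n k : ℕ) → .{{_ : NonZero n}} → .{{_ : NonZero k}} → k ∣ n →
           (π : Node k (n / k) → ℚ) → (π̃ : Node (2 * k) (n / k) → ℚ) →
           IsStationary k (n / k) π → IsStationary (2 * k) (n / k) π̃ →
           tv (2 * k) (n / k) (extend k (n / k) π) π̃ ≤ C *ℚ ((+ k /ℚ n) ^ (k ∸ 1)))
lemma4 = 1ℚ , bound
  where
  bound : (n k : ℕ) → .{{_ : NonZero n}} → .{{_ : NonZero k}} → k ∣ n →
          (π : Node k (n / k) → ℚ) → (π̃ : Node (2 * k) (n / k) → ℚ) →
          IsStationary k (n / k) π → IsStationary (2 * k) (n / k) π̃ →
          tv (2 * k) (n / k) (extend k (n / k) π) π̃ ≤ 1ℚ *ℚ ((+ k /ℚ n) ^ (k ∸ 1))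
  bound n       zero    {{_}} {{()}}
  bound .0      (suc k) {{()}} (divides zero refl)
  bound .(suc m * suc k) (suc k) (divides (suc m) refl) rewrite m*n/n≡m (suc m) (suc k) {{_}} =
    λ π π̃ st st̃ → subst (tv (2 * suc k) (suc m) (extend (suc k) (suc m) π) π̃ ≤_)
      (trans (cong (_^ k) (sym (+k/[m*k]≡recip-m k m))) (sym (*-identityˡ _)))
      (Doubling.tv≤r^k st st̃)
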